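{- Let $H$ be an implicative semilattice. For every $a\in H$ the set $S_a=\{b\in H:b\to a\le b\}$ is a filter of $H$. Moreover, if $H$ is finite, then $S_a$ has a minimum for every $a\in H$, i.e., there exists a successor function on $H$.
   Context: An implicative semilattice is $(H,\wedge,\to,1)$ where $(H,\wedge)$ is a meet-semilattice with top $1$ and $a\wedge b\le c$ iff $a\le b\to c$. A filter is an upset containing $1$ and closed under $\wedge$. A successor on (the Hilbert algebra reduct of) $H$ is a map $S:H\to H$ with $S(a)\le((b\to a)\to b)\to b$ and $S(a)\to a\le S(a)$ for all $a,b\in H$. -}

module Defs where

open import Level using (Level; suc; _⊔_)
open import Data.Product using (_×_; Σ; ∃; ∃-syntax; _,_)
open import Data.Nat using (ℕ)
open import Data.Fin using (Fin)
open import Function.Bundles using (_↔_)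
open import Relation.Binary.PropositionalEquality using (_≡_)

record ImplicativeSemilattice (c : Level) : Set (suc c) where
  infixr 6 _∧_
  infixr 5 _⇒_
  infix 4 _≤_
  field
    Carrier : Set c
    _∧_     : Carrier → Carrier → Carrier
    _⇒_     : Carrier → Carrier → Carrier
    𝟙       : Carrier
    ∧-assoc : ∀ x y z → (x ∧ y) ∧ z ≡ x ∧ (y ∧ z)
    ∧-comm  : ∀ x y → x ∧ y ≡ y ∧ x
    ∧-idem  : ∀ x → x ∧ x ≡ x

  _≤_ : Carrier → Carrier → Set c
  a ≤ b = a ∧ b ≡ a

  field
    ≤-𝟙       : ∀ x → x ≤ 𝟙
    residuate : ∀ a b c → a ∧ b ≤ c → a ≤ b ⇒ c
    unresiduate : ∀ a b c → a ≤ b ⇒ c → a ∧ b ≤ c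

module _ {c : Level} (H : ImplicativeSemilattice c) where
  open ImplicativeSemilattice H

  record IsFilter (F : Carrier → Set c) : Set c where
    field
      upset   : ∀ {x y} → x ≤ y → F x → F y
      has-𝟙   : F 𝟙
      ∧-closed : ∀ {x y} → F x → F y → F (x ∧ y)

  S[_] : Carrier → Carrier → Set c
  S[ a ] b = (b ⇒ a) ≤ b

  IsMinimum : (Carrier → Set c) → Carrier → Set c
  IsMinimum P m = P m × (∀ b → P b → m ≤ b)

  IsSuccessor : (Carrier → Carrier) → Set c
  IsSuccessor S =
    (∀ a b → S a ≤ ((b ⇒ a) ⇒ b) ⇒ b) × (∀ a → (S a ⇒ a) ≤ S a)

IsFinite : ∀ {c} → ImplicativeSemilattice c → Set c
IsFinite H = ∃[ n ] (ImplicativeSemilattice.Carrier H ↔ Fin n)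

module Submission where

open import Defs
open import Level using (Level)
open import Data.Product using (_×_; ∃; ∃-syntax; _,_; proj₁; proj₂)
open import Data.Nat using (zero; suc)
open import Data.Fin using (Fin; zero; suc)
open import Data.Fin.Properties using (inj⇒≟)
open import Data.Empty using (⊥-elim)
open import Function.Bundles using (Inverse)
open import Function.Properties.Inverse using (↔⇒↣)
open import Relation.Nullary using (Dec; yes; no)
open import Relation.Binary.PropositionalEquality
  using (_≡_; refl; sym; trans; cong; subst)

module Theory {c : Level} (H : ImplicativeSemilattice c) where
  open ImplicativeSemilattice H

  ≤-refl : ∀ x → x ≤ x
  ≤-refl = ∧-idem

  ≤-trans : ∀ {x y z} → x ≤ y → y ≤ z → x ≤ z
  ≤-trans {x} {y} {z} x≤y y≤z =
    trans (cong (_∧ z) (sym x≤y))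
      (trans (∧-assoc x y z) (trans (cong (x ∧_) y≤z) x≤y))

  ∧-lowerˡ : ∀ x y → x ∧ y ≤ x
  ∧-lowerˡ x y =
    trans (∧-assoc x y x)
      (trans (cong (x ∧_) (∧-comm y x))
        (trans (sym (∧-assoc x x y)) (cong (_∧ y) (∧-idem x))))

  ∧-lowerʳ : ∀ x y → x ∧ y ≤ y
  ∧-lowerʳ x y = trans (∧-assoc x y y) (cong (x ∧_) (∧-idem y))

  ∧-greatest : ∀ {z x y} → z ≤ x → z ≤ y → z ≤ x ∧ y
  ∧-greatest {z} {x} {y} z≤x z≤y =
    trans (sym (∧-assoc z x y)) (trans (cong (_∧ y) z≤x) z≤y)

  modus-ponens : ∀ x y → (x ⇒ y) ∧ x ≤ y
  modus-ponens x y = unresiduate (x ⇒ y) x y (≤-refl _)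

  ⇒-antitone : ∀ {x y} a → x ≤ y → (y ⇒ a) ≤ (x ⇒ a)
  ⇒-antitone {x} {y} a x≤y = residuate _ _ _ (≤-trans below-y (modus-ponens y a))
    where
    below-y : (y ⇒ a) ∧ x ≤ (y ⇒ a) ∧ y
    below-y = ∧-greatest (∧-lowerˡ _ _) (≤-trans (∧-lowerʳ _ _) x≤y)

  -- S_a is upward closed: if x ≤ y then y ⇒ a ≤ x ⇒ a ≤ x ≤ y.
  S-upset : ∀ a {x y} → x ≤ y → S[_] H a x → S[_] H a y
  S-upset a x≤y x∈S = ≤-trans (≤-trans (⇒-antitone a x≤y) x∈S) x≤y

  -- Key step for ∧-closure: with z = (x ∧ y) ⇒ a, membership y ∈ S_a gives
  -- z ∧ x ≤ y, hence z ∧ x ≤ x ∧ y and z ∧ x ≤ a; so z ≤ x ⇒ a ≤ x.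
  meet-implication-below : ∀ a {x y} → S[_] H a x → S[_] H a y →
    ((x ∧ y) ⇒ a) ≤ x
  meet-implication-below a {x} {y} x∈S y∈S =
    ≤-trans (residuate _ _ _ (≤-trans zx≤z[xy] (modus-ponens (x ∧ y) a))) x∈S
    where
    z = (x ∧ y) ⇒ a
    zx≤y : z ∧ x ≤ y
    zx≤y = ≤-trans
      (residuate _ _ _ (subst (_≤ a) (sym (∧-assoc z x y)) (modus-ponens (x ∧ y) a)))
      y∈S
    zx≤z[xy] : z ∧ x ≤ z ∧ (x ∧ y)
    zx≤z[xy] = ∧-greatest (∧-lowerˡ _ _) (∧-greatest (∧-lowerʳ _ _) zx≤y)

  S-∧-closed : ∀ a {x y} → S[_] H a x → S[_] H a y → S[_] H a (x ∧ y)
  S-∧-closed a {x} {y} x∈S y∈S =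
    ∧-greatest (meet-implication-below a x∈S y∈S)
      (subst (_≤ y) (cong (_⇒ a) (∧-comm y x)) (meet-implication-below a y∈S x∈S))

  S-filter : ∀ a → IsFilter H (S[_] H a)
  S-filter a = record
    { upset    = S-upset a
    ; has-𝟙    = ≤-𝟙 _
    ; ∧-closed = S-∧-closed a
    }

  -- ((b ⇒ a) ⇒ b) ⇒ b always lies in S_a.  Writing p = (b ⇒ a) ⇒ b,
  -- r = p ⇒ b and q = r ⇒ a, one shows q ∧ p ≤ b ⇒ a (as b ≤ r), hence
  -- q ∧ p ≤ b, i.e. q ≤ r.
  double-implication-in-S : ∀ a b → S[_] H a (((b ⇒ a) ⇒ b) ⇒ b)
  double-implication-in-S a b = residuate _ _ _ qp≤b
    where
    p = (b ⇒ a) ⇒ b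
    r = p ⇒ b
    q = r ⇒ a
    b≤r : b ≤ r
    b≤r = residuate _ _ _ (∧-lowerˡ _ _)
    qp≤b⇒a : q ∧ p ≤ b ⇒ a
    qp≤b⇒a = residuate _ _ _
      (≤-trans (∧-greatest (≤-trans (∧-lowerˡ _ _) (∧-lowerˡ _ _))
                           (≤-trans (∧-lowerʳ _ _) b≤r))
               (modus-ponens r a))
    qp≤b : q ∧ p ≤ b
    qp≤b = ≤-trans (∧-greatest (∧-lowerʳ _ _) qp≤b⇒a) (modus-ponens (b ⇒ a) b)

  module DecidableFilter (F : Carrier → Set c) (isFilter : IsFilter H F)
                         (F? : ∀ x → Dec (F x)) where
    open IsFilter isFilter

    meet-of-members : ∀ k → (Fin k → Carrier) → Carrier
    meet-of-members zero    e = 𝟙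
    meet-of-members (suc k) e with F? (e zero)
    ... | yes _ = e zero ∧ meet-of-members k (λ i → e (suc i))
    ... | no  _ = meet-of-members k (λ i → e (suc i))

    meet-of-members-∈ : ∀ k e → F (meet-of-members k e)
    meet-of-members-∈ zero    e = has-𝟙
    meet-of-members-∈ (suc k) e with F? (e zero)
    ... | yes e₀∈F = ∧-closed e₀∈F (meet-of-members-∈ k (λ i → e (suc i)))
    ... | no  _    = meet-of-members-∈ k (λ i → e (suc i))

    meet-of-members-≤ : ∀ k e i → F (e i) → meet-of-members k e ≤ e i
    meet-of-members-≤ (suc k) e i eᵢ∈F with F? (e zero)
    meet-of-members-≤ (suc k) e zero    eᵢ∈F | yes _ = ∧-lowerˡ _ _
    meet-of-members-≤ (suc k) e (suc i) eᵢ∈F | yes _ =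
      ≤-trans (∧-lowerʳ _ _) (meet-of-members-≤ k (λ j → e (suc j)) i eᵢ∈F)
    meet-of-members-≤ (suc k) e zero    eᵢ∈F | no e₀∉F = ⊥-elim (e₀∉F eᵢ∈F)
    meet-of-members-≤ (suc k) e (suc i) eᵢ∈F | no _ =
      meet-of-members-≤ k (λ j → e (suc j)) i eᵢ∈F

    minimum : ∀ k (e : Fin k → Carrier) → (∀ b → ∃[ i ] e i ≡ b) →
      ∃[ m ] IsMinimum H F m
    minimum k e onto = meet-of-members k e , meet-of-members-∈ k e , lower-bound
      where
      lower-bound : ∀ b → F b → meet-of-members k e ≤ b
      lower-bound b b∈F with onto b
      ... | i , refl = meet-of-members-≤ k e i b∈F

  -- On a finite H every S_a has a minimum: the carrier has decidable
  -- equality, so membership in S_a is decidable.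
  S-minimum : IsFinite H → ∀ a → ∃[ m ] IsMinimum H (S[_] H a) m
  S-minimum (n , H↔Fin) a =
    DecidableFilter.minimum (S[_] H a) (S-filter a) S? n from
      (λ b → to b , strictlyInverseʳ b)
    where
    open Inverse H↔Fin
    _≟_ : (x y : Carrier) → Dec (x ≡ y)
    _≟_ = inj⇒≟ (↔⇒↣ H↔Fin)
    S? : ∀ b → Dec (S[_] H a b)
    S? b = ((b ⇒ a) ∧ b) ≟ (b ⇒ a)

  minimum-is-successor : (min : ∀ a → ∃[ m ] IsMinimum H (S[_] H a) m) →
    IsSuccessor H (λ a → proj₁ (min a))
  minimum-is-successor min =
    (λ a b → proj₂ (proj₂ (min a)) _ (double-implication-in-S a b)) ,
    (λ a → proj₁ (proj₂ (min a)))

proposition5p3 : {c : Level} (H : ImplicativeSemilattice c) →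
    (∀ a → IsFilter H (S[_] H a)) ×
    (IsFinite H →
      (∀ a → ∃[ m ] IsMinimum H (S[_] H a) m) ×
      ∃[ S ] IsSuccessor H S)
proposition5p3 H = S-filter , λ finite →
  let min = S-minimum finite
  in min , (λ a → proj₁ (min a)) , minimum-is-successor min
  where open Theory H
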